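{- Over the class $\mathbb{Z}$ of frames isomorphic to $(\mathbb{Z},<)$ (the integers with their standard strict order), $\mathcal{H}(@)\prec_{\mathbb{Z}}\mathcal{ML}(\mathsf{DD})\approx_{\mathbb{Z}}\mathcal{MLC}$.
   Context: $\mathcal{ML}(\mathsf{DD})$-formulas: $\varphi ::= p \mid \neg\varphi \mid \varphi\lor\varphi \mid \Diamond\varphi \mid @_{\varphi}\varphi$, $p\in\mathsf{PROP}$; models $(W,R,V)$ with $V:\mathsf{PROP}\to\mathcal{P}(W)$; standard semantics for atoms, $\neg,\lor,\Diamond$, and $\mathcal{M},w\models @_{\varphi_1}\varphi_2$ iff some $v\in W$ satisfies both $\varphi_1$ and $\varphi_2$ and no $v'\neq v$ satisfies $\varphi_1$. $\mathcal{MLC}$-formulas: $\varphi ::= p \mid \neg\varphi \mid \varphi\lor\varphi \mid \Diamond\varphi \mid \exists_{\geq n}\varphi$, $n\in\mathbb{N}$, with $\mathcal{M},w\models\exists_{\geq n}\varphi$ iff at least $n$ worlds satisfy $\varphi$. $\mathcal{H}(@)$-formulas: $\varphi ::= p \mid i \mid \neg\varphi \mid \varphi\lor\varphi \mid \Diamond\varphi \mid @_i\varphi$, $i$ from a set $\mathsf{NOM}$ of nominals; in hybrid models $V$ additionally assigns a singleton to each nominal, $\mathcal{M},w\models i$ iff $V(i)=\{w\}$, and $\mathcal{M},w\models @_i\varphi$ iff $\varphi$ holds at the unique world of $V(i)$. Expressiveness: for a class $\mathsf{F}$ of frames and non-hybrid $\mathcal{L}_1,\mathcal{L}_2$, $\mathcal{L}_1\preccurlyeq_\mathsf{F}\mathcal{L}_2$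 means every $\mathcal{L}_1$-formula $\varphi$ has an $\mathcal{L}_2$-formula $\varphi'$ with $\mathcal{M},w\models\varphi$ iff $\mathcal{M},w\models\varphi'$ for all models $\mathcal{M}$ over frames in $\mathsf{F}$ and all worlds $w$. If exactly one of the logics is hybrid, nominals are treated as fresh propositional variables in the non-hybrid logic, and the equivalence is required as follows: truth of the hybrid formula in a hybrid model implies truth of the non-hybrid one; and whenever the non-hybrid formula holds at $w$ in a non-hybrid model, each nominal occurring in the hybrid formula is interpreted as a singleton and (viewing the model as hybrid) the hybrid formula holds at $w$ (and symmetrically when the roles are reversed). $\mathcal{L}_1\prec_\mathsf{F}\mathcal{L}_2$ means $\mathcal{L}_1\preccurlyeq_\mathsf{F}\mathcal{L}_2$ and $\mathcal{L}_2\not\preccurlyeq_\mathsf{F}\mathcal{L}_1$; $\mathcal{L}_1\approx_\mathsf{F}\mathcal{L}_2$ means both $\mathcal{L}_1\preccurlyeq_\mathsf{F}\mathcal{L}_2$ and $\mathcal{L}_2\preccurlyeq_\mathsf{F}\mathcal{L}_1$. -}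

module Defs where

open import Level using (0ℓ)
open import Data.Nat using (ℕ)
open import Data.Integer using (ℤ) renaming (_<_ to _<ℤ_)
open import Data.Fin using (Fin)
open import Data.Product using (Σ; _×_; _,_; proj₁; proj₂)
open import Data.Sum using (_⊎_; inj₁; inj₂)
open import Data.List using (List; []; _∷_; _++_)
open import Data.List.Membership.Propositional using (_∈_)
open import Function using (id)
open import Function.Bundles using (_↔_; Inverse)
open import Function.Definitions using (Injective)
open import Relation.Nullary using (¬_)
open import Relation.Binary.PropositionalEquality using (_≡_)

PROP : Set
PROP = ℕ

NOM : Set
NOM = ℕ

record Frame : Set₁ where
  field
    W : Set
    R : W → W → Set

IsZFrame : Frame → Set
IsZFrame F =
  Σ (Frame.W F ↔ ℤ) λ iso →
    ∀ x y → (Frame.R F x y → Inverse.to iso x <ℤ Inverse.to iso y)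
          × (Inverse.to iso x <ℤ Inverse.to iso y → Frame.R F x y)

record Model (A : Set) : Set₁ where
  field
    frame : Frame
    V     : A → Frame.W frame → Set
  open Frame frame public

-- hybrid model: V on PROP, and each nominal denotes a single world
-- (V(i) = { N i })
record HModel : Set₁ where
  field
    frame : Frame
    V     : PROP → Frame.W frame → Set
    N     : NOM → Frame.W frame
  open Frame frame public

IsSingleton : {W : Set} → (W → Set) → Set
IsSingleton {W} P = Σ W λ w → P w × (∀ v → P v → v ≡ w)

data DD (A : Set) : Set where
  atom : A → DD A
  neg  : DD A → DD A
  or   : DD A → DD A → DD A
  dia  : DD A → DD A
  at   : DD A → DD A → DD A

satDD : {A : Set} (M : Model A) → Model.W M → DD A → Set
satDD M w (atom p) = Model.V M p w
satDD M w (neg φ)  = ¬ satDD M w φ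
satDD M w (or φ ψ) = satDD M w φ ⊎ satDD M w ψ
satDD M w (dia φ)  = Σ (Model.W M) λ v → Model.R M w v × satDD M v φ
satDD M w (at φ ψ) =
  Σ (Model.W M) λ v → satDD M v φ × satDD M v ψ
    × (∀ v' → ¬ (v' ≡ v) → ¬ satDD M v' φ)

data C (A : Set) : Set where
  atom : A → C A
  neg  : C A → C A
  or   : C A → C A → C A
  dia  : C A → C A
  cnt  : ℕ → C A → C A

satC : {A : Set} (M : Model A) → Model.W M → C A → Set
satC M w (atom p)  = Model.V M p w
satC M w (neg φ)   = ¬ satC M w φ
satC M w (or φ ψ)  = satC M w φ ⊎ satC M w ψ
satC M w (dia φ)   = Σ (Model.W M) λ v → Model.R M w v × satC M v φ
satC M w (cnt n φ) =
  Σ (Fin n → Model.W M) λ f → Injective _≡_ _≡_ f × (∀ k → satC M (f k) φ)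

data HF : Set where
  prop : PROP → HF
  nom  : NOM → HF
  neg  : HF → HF
  or   : HF → HF → HF
  dia  : HF → HF
  at   : NOM → HF → HF

satH : (M : HModel) → HModel.W M → HF → Set
satH M w (prop p) = HModel.V M p w
satH M w (nom i)  = w ≡ HModel.N M i
satH M w (neg φ)  = ¬ satH M w φ
satH M w (or φ ψ) = satH M w φ ⊎ satH M w ψ
satH M w (dia φ)  = Σ (HModel.W M) λ v → HModel.R M w v × satH M v φ
satH M w (at i φ) = satH M (HModel.N M i) φ

noms : HF → List NOM
noms (prop p) = []
noms (nom i)  = i ∷ []
noms (neg φ)  = noms φ
noms (or φ ψ) = noms φ ++ noms ψ
noms (dia φ)  = noms φ
noms (at i φ) = i ∷ noms φ

record NHLogic : Set₁ where
  field
    Fm  : Set → Set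
    sat : {A : Set} (M : Model A) → Model.W M → Fm A → Set

MLDD : NHLogic
MLDD = record { Fm = DD ; sat = satDD }

MLC : NHLogic
MLC = record { Fm = C ; sat = satC }

FrameClass : Set₁
FrameClass = Frame → Set

_≼[_]_ : NHLogic → FrameClass → NHLogic → Set₁
L₁ ≼[ K ] L₂ =
  ∀ (φ : NHLogic.Fm L₁ PROP) → Σ (NHLogic.Fm L₂ PROP) λ φ' →
    ∀ (M : Model PROP) → K (Model.frame M) → ∀ w →
      (NHLogic.sat L₁ M w φ → NHLogic.sat L₂ M w φ')
      × (NHLogic.sat L₂ M w φ' → NHLogic.sat L₁ M w φ)

_≺[_]_ : NHLogic → FrameClass → NHLogic → Set₁
L₁ ≺[ K ] L₂ = (L₁ ≼[ K ] L₂) × ¬ (L₂ ≼[ K ] L₁)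

_≈[_]_ : NHLogic → FrameClass → NHLogic → Set₁
L₁ ≈[ K ] L₂ = (L₁ ≼[ K ] L₂) × (L₂ ≼[ K ] L₁)

-- Mixed case.  Non-hybrid formulas live over PROP ⊎ NOM (nominal i is the
-- fresh propositional variable inj₂ i).

forget : HModel → Model (PROP ⊎ NOM)
forget M = record { frame = HModel.frame M ; V = V' }
  where
    V' : PROP ⊎ NOM → HModel.W M → Set
    V' (inj₁ p) w = HModel.V M p w
    V' (inj₂ i) w = w ≡ HModel.N M i

toH : (M : Model (PROP ⊎ NOM)) → (NOM → Model.W M) → HModel
toH M n = record { frame = Model.frame M
                 ; V = λ p → Model.V M (inj₁ p) ; N = n }

reindex : {A B : Set} → (B → A) → Model A → Model B
reindex e M = record { frame = Model.frame M ; V = λ b → Model.V M (e b) }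

HEquiv : (L : NHLogic) → FrameClass → {B : Set} → (B → PROP ⊎ NOM)
       → NHLogic.Fm L B → HF → Set₁
HEquiv L K e ψ χ =
  (∀ (N : HModel) → K (HModel.frame N) → ∀ w →
     satH N w χ → NHLogic.sat L (reindex e (forget N)) w ψ)
  × (∀ (M : Model (PROP ⊎ NOM)) → K (Model.frame M) → ∀ w →
     NHLogic.sat L (reindex e M) w ψ →
       (∀ i → i ∈ noms χ → IsSingleton (Model.V M (inj₂ i)))
       × (∀ (n : NOM → Model.W M) →
            (∀ i → i ∈ noms χ → Model.V M (inj₂ i) (n i)) →
            satH (toH M n) w χ))

Hyb≼[_]_ : FrameClass → NHLogic → Set₁
Hyb≼[ K ] L = ∀ (χ : HF) → Σ (NHLogic.Fm L (PROP ⊎ NOM)) λ ψ → HEquiv L K id ψ χ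

_≼[_]Hyb : NHLogic → FrameClass → Set₁
L ≼[ K ]Hyb = ∀ (ψ : NHLogic.Fm L PROP) → Σ HF λ χ → HEquiv L K inj₁ ψ χ

Hyb≺[_]_ : FrameClass → NHLogic → Set₁
Hyb≺[ K ] L = (Hyb≼[ K ] L) × ¬ (L ≼[ K ]Hyb)

{-# OPTIONS --safe #-}
module Submission where

-- Nominals become fresh variables and @_i becomes the description @_i; adding
-- @_i i for every nominal i of χ forces each of them to denote a single world,
-- which embeds H(@) into ML(DD) over every class of frames.  Conversely, with
-- all nominals naming 1, a hybrid formula evaluated at 1 only sees the worlds
-- above 0, so it cannot tell p = {0} from p = (−∞, 0], while @_p p can.
-- The description @_φ ψ is ∃≥1 (φ ∧ ψ) ∧ ¬ ∃≥2 φ.  Over ℤ, ∃≥(k+1) φ holds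
-- iff some world (the least of k+1 witnesses) starts a strictly increasing
-- chain of k+1 φ-worlds, and "θ holds somewhere" is θ ∨ ◇θ ∨ @_ρ ρ with
-- ρ = θ ∧ ¬◇θ: a θ which holds only in the past has a greatest world, and
-- that world is the unique one satisfying ρ.

open import Defs
open import Level using (0ℓ)
open import Axiom.ExcludedMiddle using (ExcludedMiddle)
open import Axiom.DoubleNegationElimination using (em⇒dne)
open import Data.Empty using (⊥-elim)
open import Data.Fin using (Fin; zero; suc; punchIn)
open import Data.Fin.Properties using (0≢1+n; punchIn-injective; punchInᵢ≢i)
open import Data.Integer using (ℤ; +_; -[1+_]; +≤+; +<+; -≤+; _+_; _-_; ∣_∣; _≤_; _<_)
import Data.Integer.Properties as ℤ
open import Data.Integer.Tactic.RingSolver using (solve-∀)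
open import Data.List using (List; []; _∷_; foldr)
open import Data.List.Membership.Propositional using (_∈_)
open import Data.List.Relation.Unary.All as All using (All; []; _∷_)
open import Data.List.Relation.Unary.All.Properties using (++⁻ˡ; ++⁻ʳ)
open import Data.Nat as ℕ using (ℕ; zero; suc)
import Data.Nat.Properties as ℕ
open import Data.Product using (Σ; _×_; _,_; proj₁; proj₂)
open import Data.Sum using (_⊎_; inj₁; inj₂; [_,_]′)
open import Data.Sum.Function.Propositional using (_⊎-⇔_)
import Data.Vec.Functional as Vector
open import Function using (id; _∘_; _$_)
open import Function.Bundles using (_⇔_; mk⇔; Equivalence; Inverse; Injection)
open import Function.Construct.Identity using (↔-id; ⇔-id)
open import Function.Definitions using (Injective)
import Function.Properties.Equivalence as ⇔
open import Function.Properties.Inverse using (↔⇒↣)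
open import Function.Related.TypeIsomorphisms using (¬-cong-⇔)
open import Relation.Binary.PropositionalEquality using (_≡_; _≢_; refl; sym; trans; cong; subst)
open import Relation.Nullary using (¬_; yes; no)
open import Relation.Nullary.Decidable using (toSum)

open Equivalence using (to; from)

infixr 6 _∧ᴰ_ _∧ᶜ_

_∧ᴰ_ : {A : Set} → DD A → DD A → DD A
φ ∧ᴰ ψ = neg (or (neg φ) (neg ψ))

_∧ᶜ_ : {A : Set} → C A → C A → C A
φ ∧ᶜ ψ = neg (or (neg φ) (neg ψ))

exactlyOnce : {A : Set} → DD A → DD A
exactlyOnce φ = at φ φ

◇-cong : {W : Set} {R : W → W → Set} {P Q : W → Set} {w : W} →
         (∀ {v} → R w v → P v ⇔ Q v) →
         (Σ W λ v → R w v × P v) ⇔ (Σ W λ v → R w v × Q v)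
◇-cong P⇔Q = mk⇔ (λ (v , r , p) → v , r , to (P⇔Q r) p)
                 (λ (v , r , q) → v , r , from (P⇔Q r) q)

translation⇒≼ : (L₁ L₂ : NHLogic) {K : FrameClass} →
                (t : NHLogic.Fm L₁ PROP → NHLogic.Fm L₂ PROP) →
                (∀ φ (M : Model PROP) → K (Model.frame M) → ∀ w →
                   NHLogic.sat L₁ M w φ ⇔ NHLogic.sat L₂ M w (t φ)) →
                L₁ ≼[ K ] L₂
translation⇒≼ _ _ t t-correct φ =
  t φ , λ M k w → to (t-correct φ M k w) , from (t-correct φ M k w)

singleton-⇔≡ : {W : Set} {P : W → Set} {x : W} → IsSingleton P → P x → ∀ v → P v ⇔ (v ≡ x)
singleton-⇔≡ {P = P} (_ , _ , unique) px v =
  mk⇔ (λ pv → trans (unique v pv) (sym (unique _ px))) (λ v≡x → subst P (sym v≡x) px)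

AtLeast : {W : Set} → ℕ → (W → Set) → Set
AtLeast {W} n P = Σ (Fin n → W) λ f → Injective _≡_ _≡_ f × (∀ j → P (f j))

AtLeast-map : {W : Set} {P Q : W → Set} {n : ℕ} → (∀ {v} → P v → Q v) →
              AtLeast n P → AtLeast n Q
AtLeast-map P⇒Q (f , f-inj , p) = f , f-inj , P⇒Q ∘ p

AtLeast-cong : {W : Set} {P Q : W → Set} {n : ℕ} → (∀ v → P v ⇔ Q v) →
               AtLeast n P ⇔ AtLeast n Q
AtLeast-cong P⇔Q = mk⇔ (AtLeast-map λ {v} → to (P⇔Q v)) (AtLeast-map λ {v} → from (P⇔Q v))

[]-injective : {W : Set} → Injective _≡_ _≡_ (Vector.[] {A = W})
[]-injective {x = ()}

injective-∷ : {W : Set} {n : ℕ} {v : W} {f : Fin n → W} →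
              (∀ j → v ≢ f j) → Injective _≡_ _≡_ f → Injective _≡_ _≡_ (v Vector.∷ f)
injective-∷ v∉f f-inj {zero}  {zero}  _ = refl
injective-∷ v∉f f-inj {zero}  {suc j} e = ⊥-elim (v∉f j e)
injective-∷ v∉f f-inj {suc i} {zero}  e = ⊥-elim (v∉f i (sym e))
injective-∷ v∉f f-inj {suc i} {suc j} e = cong suc (f-inj e)

AtLeast-1 : {W : Set} (P : W → Set) → AtLeast 1 P ⇔ Σ W P
AtLeast-1 _ = mk⇔
  (λ (f , _ , p) → f zero , p zero)
  (λ (v , p) → v Vector.∷ Vector.[] , injective-∷ (λ ()) []-injective , λ { zero → p })

AtLeast-2 : {W : Set} (P : W → Set) →
            AtLeast 2 P ⇔ (Σ W λ u → Σ W λ v → u ≢ v × P u × P v)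
AtLeast-2 _ = mk⇔
  (λ (f , f-inj , p) → f zero , f (suc zero) , 0≢1+n ∘ f-inj , p zero , p (suc zero))
  (λ (u , v , u≢v , pu , pv) →
     u Vector.∷ v Vector.∷ Vector.[] ,
     injective-∷ (λ { zero → u≢v }) (injective-∷ (λ ()) []-injective) ,
     λ { zero → pu ; (suc zero) → pv })

¬[¬⊎¬]⇔× : ExcludedMiddle 0ℓ → {A B : Set} → (¬ (¬ A ⊎ ¬ B)) ⇔ (A × B)
¬[¬⊎¬]⇔× em = mk⇔ (λ h → em⇒dne em (h ∘ inj₁) , em⇒dne em (h ∘ inj₂))
                  (λ (a , b) → [ _$ a , _$ b ]′)

hybrid→DD : HF → DD (PROP ⊎ NOM)
hybrid→DD (prop p) = atom (inj₁ p)
hybrid→DD (nom i)  = atom (inj₂ i)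
hybrid→DD (neg χ)  = neg (hybrid→DD χ)
hybrid→DD (or χ ψ) = or (hybrid→DD χ) (hybrid→DD ψ)
hybrid→DD (dia χ)  = dia (hybrid→DD χ)
hybrid→DD (at i χ) = at (atom (inj₂ i)) (hybrid→DD χ)

withSingletons : List NOM → DD (PROP ⊎ NOM) → DD (PROP ⊎ NOM)
withSingletons is φ = foldr (λ i ψ → exactlyOnce (atom (inj₂ i)) ∧ᴰ ψ) φ is

Names : (M : Model (PROP ⊎ NOM)) → (NOM → Model.W M) → NOM → Set
Names M n i = ∀ v → Model.V M (inj₂ i) v ⇔ (v ≡ n i)

hybrid→DD-correct : (M : Model (PROP ⊎ NOM)) (n : NOM → Model.W M) (χ : HF) →
                    All (Names M n) (noms χ) →
                    ∀ {w} → satDD M w (hybrid→DD χ) ⇔ satH (toH M n) w χ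
hybrid→DD-correct M n (prop p) _ = ⇔-id _
hybrid→DD-correct M n (nom i) (named ∷ []) = named _
hybrid→DD-correct M n (neg χ) named = ¬-cong-⇔ (hybrid→DD-correct M n χ named)
hybrid→DD-correct M n (or χ ψ) named =
  hybrid→DD-correct M n χ (++⁻ˡ (noms χ) named) ⊎-⇔ hybrid→DD-correct M n ψ (++⁻ʳ (noms χ) named)
hybrid→DD-correct M n (dia χ) named = ◇-cong {R = Model.R M} λ _ → hybrid→DD-correct M n χ named
hybrid→DD-correct M n (at i χ) (named-i ∷ named) = mk⇔
  (λ (v , iv , χv , _) → subst (λ u → satH (toH M n) u χ) (to (named-i v) iv) (to χ-correct χv))
  (λ χni → n i , from (named-i (n i)) refl , from χ-correct χni ,
           λ v v≢ni iv → v≢ni (to (named-i v) iv))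
  where
    χ-correct : ∀ {w} → satDD M w (hybrid→DD χ) ⇔ satH (toH M n) w χ
    χ-correct = hybrid→DD-correct M n χ named

module _ (em : ExcludedMiddle 0ℓ) where

  exactlyOnce-⇔ : {A : Set} (M : Model A) (φ : DD A) (w : Model.W M) →
                  satDD M w (exactlyOnce φ) ⇔ IsSingleton (λ v → satDD M v φ)
  exactlyOnce-⇔ M φ w = mk⇔
    (λ (v , p , _ , only) → v , p , λ v' p' → em⇒dne em λ v'≢v → only v' v'≢v p')
    (λ (v , p , unique) → v , p , p , λ v' v'≢v p' → v'≢v (unique v' p'))

  withSingletons-⇔ : (M : Model (PROP ⊎ NOM)) (is : List NOM) {φ : DD (PROP ⊎ NOM)} {w : Model.W M} →
                     satDD M w (withSingletons is φ) ⇔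
                     (All (λ i → IsSingleton (Model.V M (inj₂ i))) is × satDD M w φ)
  withSingletons-⇔ M []       = mk⇔ ([] ,_) proj₂
  withSingletons-⇔ M (i ∷ is) {φ} {w} = mk⇔
    (λ s → let (once , rest)  = to (¬[¬⊎¬]⇔× em) s
               (singles , sφ) = to rest⇔ rest
           in to once⇔ once ∷ singles , sφ)
    (λ { (single ∷ singles , sφ) → from (¬[¬⊎¬]⇔× em) (from once⇔ single , from rest⇔ (singles , sφ)) })
    where
      once⇔ = exactlyOnce-⇔ M (atom (inj₂ i)) w
      rest⇔ = withSingletons-⇔ M is {φ} {w}

  hybrid≼DD : (K : FrameClass) → Hyb≼[ K ] MLDD
  hybrid≼DD K χ = withSingletons (noms χ) (hybrid→DD χ) , sound , complete
    where
      sound : ∀ N → K (HModel.frame N) → ∀ w → satH N w χ →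
              satDD (forget N) w (withSingletons (noms χ) (hybrid→DD χ))
      sound N _ w χw = from (withSingletons-⇔ (forget N) (noms χ))
        ( All.universal (λ i → HModel.N N i , refl , λ _ → id) _
        , from (hybrid→DD-correct (forget N) (HModel.N N) χ (All.universal (λ _ _ → ⇔-id _) _)) χw)

      complete : ∀ M → K (Model.frame M) → ∀ w →
                 satDD M w (withSingletons (noms χ) (hybrid→DD χ)) →
                 (∀ i → i ∈ noms χ → IsSingleton (Model.V M (inj₂ i)))
                 × (∀ n → (∀ i → i ∈ noms χ → Model.V M (inj₂ i) (n i)) → satH (toH M n) w χ)
      complete M _ w s = (λ _ → All.lookup singles) , λ n n-named →
        to (hybrid→DD-correct M n χ (All.tabulate λ i∈ →
              singleton-⇔≡ (All.lookup singles i∈) (n-named _ i∈))) sφ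
        where
          singles = proj₁ (to (withSingletons-⇔ M (noms χ)) s)
          sφ      = proj₂ (to (withSingletons-⇔ M (noms χ)) s)

module _ (F : Frame) (n : NOM → Frame.W F) (U : Frame.W F → Set)
         (U-upward : ∀ {w v} → Frame.R F w v → U w → U v) (U-named : ∀ i → U (n i))
         (V₁ V₂ : PROP → Frame.W F → Set) (V₁⇔V₂ : ∀ p {w} → U w → V₁ p w ⇔ V₂ p w) where

  satH-local : ∀ χ {w} → U w →
               satH (record { frame = F ; V = V₁ ; N = n }) w χ ⇔
               satH (record { frame = F ; V = V₂ ; N = n }) w χ
  satH-local (prop p) u = V₁⇔V₂ p u
  satH-local (nom i)  u = ⇔-id _
  satH-local (neg χ)  u = ¬-cong-⇔ (satH-local χ u)
  satH-local (or χ ψ) u = satH-local χ u ⊎-⇔ satH-local ψ u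
  satH-local (dia χ)  u = ◇-cong {R = Frame.R F} λ r → satH-local χ (U-upward r u)
  satH-local (at i χ) u = satH-local χ (U-named i)

ℤ-frame : Frame
ℤ-frame = record { W = ℤ ; R = _<_ }

ℤ-frame-isZ : IsZFrame ℤ-frame
ℤ-frame-isZ = ↔-id ℤ , λ _ _ → id , id

point : Model (PROP ⊎ NOM)
point = record { frame = ℤ-frame ; V = [ (λ _ w → w ≡ + 0) , (λ _ w → w ≡ + 1) ]′ }

ray : HModel
ray = record { frame = ℤ-frame ; V = λ _ w → w ≤ + 0 ; N = λ _ → + 1 }

ray-not-exactlyOnce : ∀ w → ¬ satDD (reindex inj₁ (forget ray)) w (exactlyOnce (atom 0))
ray-not-exactlyOnce _ (v , _ , _ , only) with v ℤ.≟ + 0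
... | yes refl = only -[1+ 0 ] (λ ()) -≤+
... | no v≢0   = only (+ 0) (v≢0 ∘ sym) ℤ.≤-refl

DD⋠hybrid : ¬ (MLDD ≼[ IsZFrame ]Hyb)
DD⋠hybrid translation with translation (exactlyOnce (atom 0))
... | χ , sound , complete = ray-not-exactlyOnce (+ 1) (sound ray ℤ-frame-isZ (+ 1) χ-on-ray)
  where
    0<1 : + 0 < + 1
    0<1 = +<+ (ℕ.s≤s ℕ.z≤n)

    χ-on-point : satH (toH point (λ _ → + 1)) (+ 1) χ
    χ-on-point = proj₂ (complete point ℤ-frame-isZ (+ 1) (+ 0 , refl , refl , λ _ v≢0 → v≢0))
                       (λ _ → + 1) (λ _ _ → refl)

    point⇔ray : ∀ p {w} → + 0 < w → (w ≡ + 0) ⇔ (w ≤ + 0)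
    point⇔ray _ 0<w = mk⇔ (λ w≡0 → ⊥-elim (ℤ.<-irrefl (sym w≡0) 0<w))
                          (λ w≤0 → ⊥-elim (ℤ.<⇒≱ 0<w w≤0))

    χ-on-ray : satH ray (+ 1) χ
    χ-on-ray = to (satH-local ℤ-frame (λ _ → + 1) (+ 0 <_) (λ r u → ℤ.<-trans u r) (λ _ → 0<1)
                              (λ _ w → w ≡ + 0) (λ _ w → w ≤ + 0) point⇔ray χ 0<1)
                  χ-on-point

DD→C : {A : Set} → DD A → C A
DD→C (atom p) = atom p
DD→C (neg φ)  = neg (DD→C φ)
DD→C (or φ ψ) = or (DD→C φ) (DD→C ψ)
DD→C (dia φ)  = dia (DD→C φ)
DD→C (at φ ψ) = cnt 1 (DD→C φ ∧ᶜ DD→C ψ) ∧ᶜ neg (cnt 2 (DD→C φ))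

module _ (em : ExcludedMiddle 0ℓ) {A : Set} (M : Model A) where

  DD→C-correct : ∀ φ {w} → satDD M w φ ⇔ satC M w (DD→C φ)
  DD→C-correct (atom p) = ⇔-id _
  DD→C-correct (neg φ)  = ¬-cong-⇔ (DD→C-correct φ)
  DD→C-correct (or φ ψ) = DD→C-correct φ ⊎-⇔ DD→C-correct ψ
  DD→C-correct (dia φ)  = ◇-cong {R = Model.R M} λ _ → DD→C-correct φ
  DD→C-correct (at φ ψ) {w} = mk⇔ count describe
    where
      ⟦_⟧ : C A → Model.W M → Set
      ⟦ χ ⟧ v = satC M v χ

      φ⇔ : ∀ {v} → satDD M v φ ⇔ ⟦ DD→C φ ⟧ v
      φ⇔ = DD→C-correct φ

      ψ⇔ : ∀ {v} → satDD M v ψ ⇔ ⟦ DD→C ψ ⟧ v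
      ψ⇔ = DD→C-correct ψ

      count : satDD M w (at φ ψ) → satC M w (DD→C (at φ ψ))
      count (v , φv , ψv , only) = from (¬[¬⊎¬]⇔× em)
        ( from (AtLeast-1 ⟦ DD→C φ ∧ᶜ DD→C ψ ⟧) (v , from (¬[¬⊎¬]⇔× em) (to φ⇔ φv , to ψ⇔ ψv))
        , λ two → let (u , u' , u≢u' , φu , φu') = to (AtLeast-2 ⟦ DD→C φ ⟧) two in
            -- the goal is ⊥, so whether u ≡ v need not be decided
            only u (λ u≡v → only u' (λ u'≡v → u≢u' (trans u≡v (sym u'≡v))) (from φ⇔ φu'))
                   (from φ⇔ φu))

      describe : satC M w (DD→C (at φ ψ)) → satDD M w (at φ ψ)
      describe s =
        let (one , ¬two) = to (¬[¬⊎¬]⇔× em) s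
            (v , φψv)    = to (AtLeast-1 ⟦ DD→C φ ∧ᶜ DD→C ψ ⟧) one
            (φv , ψv)    = to (¬[¬⊎¬]⇔× em) φψv
        in v , from φ⇔ φv , from ψ⇔ ψv ,
           λ v' v'≢v φv' → ¬two (from (AtLeast-2 ⟦ DD→C φ ⟧) (v' , v , v'≢v , to φ⇔ φv' , φv))

DD≼C : ExcludedMiddle 0ℓ → (K : FrameClass) → MLDD ≼[ K ] MLC
DD≼C em K = translation⇒≼ MLDD MLC DD→C λ φ M _ _ → DD→C-correct em M φ

chain : {A : Set} → ℕ → DD A → DD A
chain zero    φ = φ
chain (suc k) φ = φ ∧ᴰ dia (chain k φ)

final : {A : Set} → DD A → DD A
final θ = θ ∧ᴰ neg (dia θ)

somewhere : {A : Set} → DD A → DD A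
somewhere θ = or θ (or (dia θ) (exactlyOnce (final θ)))

C→DD : {A : Set} → C A → DD A
C→DD (atom p)        = atom p
C→DD (neg φ)         = neg (C→DD φ)
C→DD (or φ ψ)        = or (C→DD φ) (C→DD ψ)
C→DD (dia φ)         = dia (C→DD φ)
C→DD (cnt zero φ)    = or (C→DD φ) (neg (C→DD φ))
C→DD (cnt (suc k) φ) = somewhere (chain k (C→DD φ))

argmin : ∀ {k} (h : Fin (suc k) → ℤ) → Σ (Fin (suc k)) λ j → ∀ i → h j ≤ h i
argmin {zero}  h = zero , λ { zero → ℤ.≤-refl }
argmin {suc k} h with argmin (h ∘ suc)
... | j , min with ℤ.≤-total (h zero) (h (suc j))
...   | inj₁ h0≤ = zero , λ { zero → ℤ.≤-refl ; (suc i) → ℤ.≤-trans h0≤ (min i) }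
...   | inj₂ ≤h0 = suc j , λ { zero → ≤h0 ; (suc i) → min i }

i+[j-i]≡j : ∀ i j → i + (j - i) ≡ j
i+[j-i]≡j = solve-∀

i≤j⇒i+∣j-i∣≡j : ∀ {i j} → i ≤ j → i + + ∣ j - i ∣ ≡ j
i≤j⇒i+∣j-i∣≡j {i} {j} i≤j =
  trans (cong (λ x → i + x) (ℤ.0≤i⇒+∣i∣≡i (ℤ.i≤j⇒0≤j-i i≤j))) (i+[j-i]≡j i j)

module _ (em : ExcludedMiddle 0ℓ) where

  greatest-ℕ : (P : ℕ → Set) → P 0 → ∀ n → (∀ k → n ℕ.≤ k → ¬ P k) →
               Σ ℕ λ m → P m × (∀ k → P k → k ℕ.≤ m)
  greatest-ℕ P P0 zero    none = ⊥-elim (none 0 ℕ.z≤n P0)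
  greatest-ℕ P P0 (suc n) none with em {P n}
  ... | yes Pn = n , Pn , λ k Pk → ℕ.≮⇒≥ λ n<k → none k n<k Pk
  ... | no ¬Pn = greatest-ℕ P P0 n λ k n≤k →
                   [ none k , (λ { refl → ¬Pn }) ]′ (ℕ.m≤n⇒m<n∨m≡n n≤k)

  greatest-ℤ : (P : ℤ → Set) {a b : ℤ} → P a → (∀ z → b ≤ z → ¬ P z) →
               Σ ℤ λ m → P m × (∀ z → P z → z ≤ m)
  greatest-ℤ P {a} {b} Pa none with ℤ.≤-total a b
  ... | inj₂ b≤a = ⊥-elim (none a b≤a Pa)
  ... | inj₁ a≤b with greatest-ℕ (λ k → P (a + + k)) (subst P (sym (ℤ.+-identityʳ a)) Pa) ∣ b - a ∣
                       (λ k ∣b-a∣≤k → none (a + + k) (subst (_≤ a + + k) (i≤j⇒i+∣j-i∣≡j a≤b)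
                                                           (ℤ.+-monoʳ-≤ a (+≤+ ∣b-a∣≤k))))
  ...   | m , Pm , greatest = a + + m , Pm , below
    where
      below : ∀ z → P z → z ≤ a + + m
      below z Pz with ℤ.≤-total a z
      ... | inj₂ z≤a = ℤ.≤-trans z≤a (ℤ.i≤i+j a (+ m))
      ... | inj₁ a≤z = subst (_≤ a + + m) (i≤j⇒i+∣j-i∣≡j a≤z)
                         (ℤ.+-monoʳ-≤ a (+≤+ (greatest ∣ z - a ∣ (subst P (sym (i≤j⇒i+∣j-i∣≡j a≤z)) Pz))))

  module ℤ-Ordered {A : Set} (M : Model A)
                   (ι : Model.W M → ℤ) (ι-injective : Injective _≡_ _≡_ ι)
                   (R⇒< : ∀ {u v} → Model.R M u v → ι u < ι v)
                   (<⇒R : ∀ {u v} → ι u < ι v → Model.R M u v) where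

    open Model M using (W)

    ⟦_⟧ : DD A → W → Set
    ⟦ φ ⟧ v = satDD M v φ

    Greatest : DD A → W → Set
    Greatest θ u = ⟦ θ ⟧ u × (∀ v → ⟦ θ ⟧ v → ι v ≤ ι u)

    greatest-exists : ∀ θ {v w} → ⟦ θ ⟧ v → (∀ u → ι w ≤ ι u → ¬ ⟦ θ ⟧ u) → Σ W (Greatest θ)
    greatest-exists θ {v} θv none
      with greatest-ℤ (λ z → Σ W λ u → ι u ≡ z × ⟦ θ ⟧ u) (v , refl , θv)
                      (λ z w≤z (u , ιu≡z , θu) → none u (subst (_ ≤_) (sym ιu≡z) w≤z) θu)
    ... | m , (u , ιu≡m , θu) , max =
      u , θu , λ v' θv' → subst (ι v' ≤_) (sym ιu≡m) (max (ι v') (v' , refl , θv'))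

    greatest⇒exactlyOnce-final : ∀ θ {u} → Greatest θ u → ∀ w → ⟦ exactlyOnce (final θ) ⟧ w
    greatest⇒exactlyOnce-final θ {u} (θu , max) _ = u , final-u , final-u , unique
      where
        final-u : ⟦ final θ ⟧ u
        final-u = from (¬[¬⊎¬]⇔× em) (θu , λ (v , r , θv) → ℤ.<⇒≱ (R⇒< r) (max v θv))

        unique : ∀ v → v ≢ u → ¬ ⟦ final θ ⟧ v
        unique v v≢u final-v =
          let (θv , ¬◇θ) = to (¬[¬⊎¬]⇔× em) final-v
          in ¬◇θ (u , <⇒R (ℤ.≤∧≢⇒< (max v θv) (v≢u ∘ ι-injective)) , θu)

    somewhere-⇔ : ∀ θ {w} → ⟦ somewhere θ ⟧ w ⇔ Σ W ⟦ θ ⟧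
    somewhere-⇔ θ {w} = mk⇔ witness search
      where
        witness : ⟦ somewhere θ ⟧ w → Σ W ⟦ θ ⟧
        witness (inj₁ θw)                       = w , θw
        witness (inj₂ (inj₁ (v , _ , θv)))      = v , θv
        witness (inj₂ (inj₂ (v , final-v , _))) = v , proj₁ (to (¬[¬⊎¬]⇔× em) final-v)

        search : Σ W ⟦ θ ⟧ → ⟦ somewhere θ ⟧ w
        search (v , θv) with em {Σ W λ u → ι w ≤ ι u × ⟦ θ ⟧ u}
        ... | yes (u , w≤u , θu) with ι w ℤ.≟ ι u
        ...   | yes ιw≡ιu = inj₁ (subst ⟦ θ ⟧ (sym (ι-injective ιw≡ιu)) θu)
        ...   | no ιw≢ιu  = inj₂ (inj₁ (u , <⇒R (ℤ.≤∧≢⇒< w≤u ιw≢ιu) , θu))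
        search (v , θv) | no none = inj₂ (inj₂ (greatest⇒exactlyOnce-final θ (proj₂ greatest) w))
          where
            greatest : Σ W (Greatest θ)
            greatest = greatest-exists θ θv λ u w≤u θu → none (u , w≤u , θu)

    chain-sound : ∀ k φ {u} → ⟦ chain k φ ⟧ u → AtLeast (suc k) (λ v → ⟦ φ ⟧ v × ι u ≤ ι v)
    chain-sound zero φ {u} φu =
      u Vector.∷ Vector.[] , injective-∷ (λ ()) []-injective , λ { zero → φu , ℤ.≤-refl }
    chain-sound (suc k) φ {u} s with to (¬[¬⊎¬]⇔× em) s
    ... | φu , (v , r , chain-v) with chain-sound k φ chain-v
    ...   | f , f-inj , p =
      u Vector.∷ f , injective-∷ (λ j u≡fj → ℤ.<-irrefl (cong ι u≡fj) (u<f j)) f-inj ,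
      λ { zero → φu , ℤ.≤-refl ; (suc j) → proj₁ (p j) , ℤ.<⇒≤ (u<f j) }
      where
        u<f : ∀ j → ι u < ι (f j)
        u<f j = ℤ.<-≤-trans (R⇒< r) (proj₂ (p j))

    chain-complete : ∀ k φ (f : Fin (suc k) → W) → Injective _≡_ _≡_ f → (∀ j → ⟦ φ ⟧ (f j)) →
                     Σ (Fin (suc k)) λ j → ⟦ chain k φ ⟧ (f j)
    chain-complete zero    φ f _     p = zero , p zero
    chain-complete (suc k) φ f f-inj p with argmin (ι ∘ f)
    ... | j₀ , min with chain-complete k φ (f ∘ punchIn j₀) (punchIn-injective j₀ _ _ ∘ f-inj)
                                           (p ∘ punchIn j₀)
    ...   | j , chain-j = j₀ , from (¬[¬⊎¬]⇔× em) (p j₀ , f (punchIn j₀ j) , <⇒R j₀<j , chain-j)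
      where
        j₀<j : ι (f j₀) < ι (f (punchIn j₀ j))
        j₀<j = ℤ.≤∧≢⇒< (min (punchIn j₀ j)) (punchInᵢ≢i j₀ j ∘ sym ∘ f-inj ∘ ι-injective)

    AtLeast-suc⇔chain : ∀ k φ → AtLeast (suc k) ⟦ φ ⟧ ⇔ Σ W ⟦ chain k φ ⟧
    AtLeast-suc⇔chain k φ = mk⇔
      (λ (f , f-inj , p) → let (j , chain-j) = chain-complete k φ f f-inj p in f j , chain-j)
      (λ (u , chain-u) → AtLeast-map {P = λ v → ⟦ φ ⟧ v × ι u ≤ ι v} proj₁ (chain-sound k φ chain-u))

    C→DD-correct : ∀ φ {w} → satC M w φ ⇔ ⟦ C→DD φ ⟧ w
    C→DD-correct (atom p)        = ⇔-id _
    C→DD-correct (neg φ)         = ¬-cong-⇔ (C→DD-correct φ)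
    C→DD-correct (or φ ψ)        = C→DD-correct φ ⊎-⇔ C→DD-correct ψ
    C→DD-correct (dia φ)         = ◇-cong {R = Model.R M} λ _ → C→DD-correct φ
    C→DD-correct (cnt zero φ)    = mk⇔ (λ _ → toSum em) (λ _ → Vector.[] , (λ { {()} }) , λ ())
    C→DD-correct (cnt (suc k) φ) =
      ⇔.trans (AtLeast-cong λ v → C→DD-correct φ {v})
              (⇔.trans (AtLeast-suc⇔chain k (C→DD φ)) (⇔.sym (somewhere-⇔ (chain k (C→DD φ)))))

  C≼DD : MLC ≼[ IsZFrame ] MLDD
  C≼DD = translation⇒≼ MLC MLDD C→DD λ φ M (iso , R⇔<) _ →
    ℤ-Ordered.C→DD-correct M (Inverse.to iso) (Injection.injective (↔⇒↣ iso))
                             (proj₁ (R⇔< _ _)) (proj₂ (R⇔< _ _)) φ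

theorem6 : ExcludedMiddle 0ℓ → (Hyb≺[ IsZFrame ] MLDD) × (MLDD ≈[ IsZFrame ] MLC)
theorem6 em = (hybrid≼DD em IsZFrame , DD⋠hybrid) , (DD≼C em IsZFrame , C≼DD em)
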